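{- Let $\mathcal{M}'_1=(\mathcal{N}',\mathcal{I}'_1,w)$, $\mathcal{M}'_2=(\mathcal{N}',\mathcal{I}'_2,w)$ be weighted matroids with $w(e)\in\{1,2,\dots,W\}$ for all $e\in\mathcal{N}'$, and let $\mathcal{M}_1=(\mathcal{N},\mathcal{I}_1)$, $\mathcal{M}_2=(\mathcal{N},\mathcal{I}_2)$ be obtained by unfolding. Then $\mathcal{M}_1$ and $\mathcal{M}_2$ are matroids.
   Context: Unfolding: the ground set $\mathcal{N}$ consists of copies $e_1,\dots,e_{w(e)}$ for each $e\in\mathcal{N}'$. For $I\subseteq\mathcal{N}$ and $i\in[W]$ let $I'_{1,i}=\{e: e_i\in I\}$ and $I'_{2,i}=\{e: e_{w(e)-i+1}\in I\}$. Then $I\in\mathcal{I}_1$ iff $I'_{1,i}\in\mathcal{I}'_1$ for all $i\in[W]$, and $I\in\mathcal{I}_2$ iff $I'_{2,i}\in\mathcal{I}'_2$ for all $i\in[W]$. A matroid is a pair (ground set, family of independent sets) where $\emptyset$ is independent, subsets of independent sets are independent, and the exchange property holds. -}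

module Defs where

open import Data.Nat using (ℕ; zero; suc; _<_; _≤_; _∸_; _<?_; _≤?_)
open import Data.Fin using (Fin; toℕ; fromℕ<)
open import Data.Bool using (Bool; true; false; _∨_)
open import Data.List using (List; length; filter; concatMap; map; allFin)
open import Data.Product using (Σ; _×_; _,_; ∃-syntax)
open import Relation.Nullary using (yes; no)
open import Relation.Nullary.Decidable using (T?)
open import Relation.Binary.PropositionalEquality using (_≡_; _≢_)

-- A finite ground set: a carrier type together with an enumeration
-- listing every element exactly once (we only use it to count).

Subset : Set → Set
Subset A = A → Bool

∅ : {A : Set} → Subset A
∅ _ = false

_⊆_ : {A : Set} → Subset A → Subset A → Set
X ⊆ Y = ∀ a → X a ≡ true → Y a ≡ true

card : {A : Set} → List A → Subset A → ℕ
card enum X = length (filter (λ a → T? (X a)) enum)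

insert : {A : Set} → ((a b : A) → Bool) → A → Subset A → Subset A
insert eq e X a = eq e a ∨ X a

record IsMatroid {A : Set} (enum : List A) (eq : A → A → Bool)
                 (I : Subset A → Set) : Set₁ where
  field
    empty      : I ∅
    hereditary : ∀ X Y → X ⊆ Y → I Y → I X
    exchange   : ∀ X Y → I X → I Y → card enum X < card enum Y →
                 ∃[ e ] (Y e ≡ true × X e ≡ false × I (insert eq e X))

enumFin : (n : ℕ) → List (Fin n)
enumFin n = allFin n

eqFin : {n : ℕ} → Fin n → Fin n → Bool
eqFin a b with toℕ a Data.Nat.≟ toℕ b
... | yes _ = true
... | no  _ = false

-- The unfolded ground set 𝒩: copies e_1,…,e_{w(e)} of each e ∈ 𝒩'.
-- The copy e_k (1 ≤ k ≤ w e) is represented as (e , k-1) with k-1 : Fin (w e).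
Unfold : (n : ℕ) → (Fin n → ℕ) → Set
Unfold n w = Σ (Fin n) (λ e → Fin (w e))

enumUnfold : (n : ℕ) (w : Fin n → ℕ) → List (Unfold n w)
enumUnfold n w = concatMap (λ e → map (λ k → (e , k)) (allFin (w e))) (allFin n)

eqUnfold : {n : ℕ} {w : Fin n → ℕ} → Unfold n w → Unfold n w → Bool
eqUnfold (e , k) (f , l) with toℕ e Data.Nat.≟ toℕ f | toℕ k Data.Nat.≟ toℕ l
... | yes _ | yes _ = true
... | _     | _     = false

-- copy e (j) : membership of the copy with 0-based index j (i.e. e_{j+1}) in I;
-- false if no such copy exists (j ≥ w e).
copy : {n : ℕ} {w : Fin n → ℕ} → Subset (Unfold n w) → Fin n → ℕ → Bool
copy {w = w} I e j with j <? w e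
... | yes p = I (e , fromℕ< p)
... | no  _ = false

-- I'_{1,i} = { e : e_i ∈ I },  i = suc (toℕ i₀) for i₀ : Fin W
proj1 : {n W : ℕ} {w : Fin n → ℕ} → Subset (Unfold n w) → Fin W → Subset (Fin n)
proj1 I i₀ e = copy I e (toℕ i₀)

-- I'_{2,i} = { e : e_{w(e)-i+1} ∈ I },  i = suc (toℕ i₀);
-- the 0-based index of e_{w(e)-i+1} is w e ∸ i, valid iff i ≤ w e.
proj2 : {n W : ℕ} {w : Fin n → ℕ} → Subset (Unfold n w) → Fin W → Subset (Fin n)
proj2 {w = w} I i₀ e with suc (toℕ i₀) ≤? w e
... | yes _ = copy I e (w e ∸ suc (toℕ i₀))
... | no  _ = false

Unfolded1 : {n : ℕ} (W : ℕ) (w : Fin n → ℕ) → (Subset (Fin n) → Set) → Subset (Unfold n w) → Set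
Unfolded1 {n} W w I' I = (i : Fin W) → I' (proj1 {n} {W} {w} I i)

Unfolded2 : {n : ℕ} (W : ℕ) (w : Fin n → ℕ) → (Subset (Fin n) → Set) → Subset (Unfold n w) → Set
Unfolded2 {n} W w I' I = (i : Fin W) → I' (proj2 {n} {W} {w} I i)

{-# OPTIONS --safe #-}

-- Every copy of an element lies on exactly one of the layers 1, …, W: for 𝓜₁ the copy e_i lies on
-- layer i, for 𝓜₂ on layer w(e) − i + 1, and I'_{1,i} (resp. I'_{2,i}) is layer i of I read back
-- in 𝓝'. Both families thus say "every layer is independent in 𝓜'", which is closed under subsets,
-- and |I| is the sum of the layer sizes. If |X| < |Y|, some layer i has |X'_i| < |Y'_i|; exchanging
-- in 𝓜' on that layer gives e, and adding the copy of e on layer i to X changes layer i only, by e.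

module Submission where

open import Defs
open import Data.Nat using (ℕ; _≤_)
open import Data.Fin using (Fin)
open import Data.Product using (_×_)

open import Data.Bool using (Bool; true; false; _∨_)
open import Data.Bool.Properties using (∨-zeroʳ)
open import Data.Fin using (toℕ; fromℕ<; inject≤; opposite; zero; suc)
open import Data.Fin.Permutation using (reverse)
open import Data.Fin.Properties
  using (toℕ-injective; toℕ-fromℕ<; fromℕ<-toℕ; toℕ<n; toℕ-inject≤; opposite-prop;
         ¬∀⟶∃¬)
import Data.Fin.Properties as Fin
open import Data.List using (List; allFin; _++_; length; filter; tabulate; concatMap; map)
open import Data.List.Properties using (length-++; filter-++; map-tabulate)
open import Data.Maybe using (Maybe; just; nothing; maybe′)
open import Data.Nat using (zero; suc; _+_; _∸_; _<_; _<?_; _≤?_; z≤n; s≤s)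
open import Data.Nat.Properties
  using (+-0-commutativeMonoid; +-mono-≤; <⇒≱; ≰⇒>; ∸-cancelˡ-≡; suc-injective; _≟_)
open import Data.Product using (_,_; proj₂; ∃-syntax)
import Data.Product as Product
open import Data.Sum using (_⊎_; inj₁; inj₂)
open import Function using (_∘_; id)
open import Relation.Nullary using (yes; no; contradiction)
open import Relation.Nullary.Decidable using (T?)
open import Relation.Binary.PropositionalEquality
  using (_≡_; _≢_; refl; sym; trans; cong; cong₂; subst; subst₂; module ≡-Reasoning)
open import Algebra.Properties.CommutativeMonoid.Sum +-0-commutativeMonoid
  using (sum-syntax; sum-cong-≗; ∑-comm; ∑-permute)

𝟙 : Bool → ℕ
𝟙 true  = 1
𝟙 false = 0

∑-mono-≤ : ∀ {m} {f g : Fin m → ℕ} → (∀ i → f i ≤ g i) →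
           ∑[ i < m ] f i ≤ ∑[ i < m ] g i
∑-mono-≤ {zero}  f≤g = z≤n
∑-mono-≤ {suc m} f≤g = +-mono-≤ (f≤g zero) (∑-mono-≤ (f≤g ∘ suc))

∑-<⇒∃< : ∀ {m} (f g : Fin m → ℕ) → ∑[ i < m ] f i < ∑[ i < m ] g i → ∃[ i ] f i < g i
∑-<⇒∃< {m} f g ∑f<∑g =
  Product.map₂ ≰⇒> (¬∀⟶∃¬ m (λ i → g i ≤ f i) (λ i → g i ≤? f i) (<⇒≱ ∑f<∑g ∘ ∑-mono-≤))

∑-inject≤ : ∀ {m W} (m≤W : m ≤ W) (f : Fin W → ℕ) → (∀ i → m ≤ toℕ i → f i ≡ 0) →
            ∑[ i < W ] f i ≡ ∑[ k < m ] f (inject≤ k m≤W)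
∑-inject≤ {zero}  {zero}  _         f _      = refl
∑-inject≤ {zero}  {suc W} z≤n       f vanish =
  cong₂ _+_ (vanish zero z≤n) (∑-inject≤ z≤n (f ∘ suc) (λ i _ → vanish (suc i) z≤n))
∑-inject≤ {suc m} {suc W} (s≤s m≤W) f vanish =
  cong (f zero +_) (∑-inject≤ m≤W (f ∘ suc) (λ i m≤i → vanish (suc i) (s≤s m≤i)))

card-++ : ∀ {A : Set} (xs ys : List A) (X : Subset A) →
          card (xs ++ ys) X ≡ card xs X + card ys X
card-++ xs ys X = trans (cong length (filter-++ (T? ∘ X) xs ys)) (length-++ (filter (T? ∘ X) xs))

card-tabulate : ∀ {A : Set} {m} (f : Fin m → A) (X : Subset A) →
                card (tabulate f) X ≡ ∑[ k < m ] 𝟙 (X (f k))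
card-tabulate {m = zero}  f X = refl
card-tabulate {m = suc m} f X with X (f zero)
... | true  = cong suc (card-tabulate (f ∘ suc) X)
... | false = card-tabulate (f ∘ suc) X

card-concatMap-tabulate : ∀ {A B : Set} {m} (F : B → List A) (f : Fin m → B) (X : Subset A) →
                          card (concatMap F (tabulate f)) X ≡ ∑[ k < m ] card (F (f k)) X
card-concatMap-tabulate {m = zero}  F f X = refl
card-concatMap-tabulate {m = suc m} F f X =
  trans (card-++ (F (f zero)) _ X)
        (cong (card (F (f zero)) X +_) (card-concatMap-tabulate F (f ∘ suc) X))

card-enumFin : ∀ n (Z : Subset (Fin n)) → card (enumFin n) Z ≡ ∑[ e < n ] 𝟙 (Z e)
card-enumFin n = card-tabulate id

card-enumUnfold : ∀ n (w : Fin n → ℕ) (X : Subset (Unfold n w)) →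
                  card (enumUnfold n w) X ≡ ∑[ e < n ] ∑[ k < w e ] 𝟙 (X (e , k))
card-enumUnfold n w X =
  trans (card-concatMap-tabulate (λ e → map (e ,_) (allFin (w e))) id X) (sum-cong-≗ copies)
  where
  copies : ∀ e → card (map (e ,_) (allFin (w e))) X ≡ ∑[ k < w e ] 𝟙 (X (e , k))
  copies e = trans (cong (λ xs → card xs X) (map-tabulate id (e ,_))) (card-tabulate (e ,_) X)

card-enumUnfold-layers :
  ∀ {n W} {w : Fin n → ℕ} (layer : Subset (Unfold n w) → Fin W → Subset (Fin n)) →
  (∀ X e → ∑[ i < W ] 𝟙 (layer X i e) ≡ ∑[ k < w e ] 𝟙 (X (e , k))) →
  ∀ X → card (enumUnfold n w) X ≡ ∑[ i < W ] card (enumFin n) (layer X i)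
card-enumUnfold-layers {n} {W} {w} layer fibre X = begin
  card (enumUnfold n w) X                   ≡⟨ card-enumUnfold n w X ⟩
  ∑[ e < n ] ∑[ k < w e ] 𝟙 (X (e , k))     ≡⟨ sum-cong-≗ (fibre X) ⟨
  ∑[ e < n ] ∑[ i < W ] 𝟙 (layer X i e)     ≡⟨ ∑-comm (λ i e → 𝟙 (layer X i e)) ⟨
  ∑[ i < W ] ∑[ e < n ] 𝟙 (layer X i e)     ≡⟨ sum-cong-≗ (λ i → card-enumFin n (layer X i)) ⟨
  ∑[ i < W ] card (enumFin n) (layer X i)   ∎
  where open ≡-Reasoning

⊆-insert : ∀ {A : Set} (eq : A → A → Bool) e (X : Subset A) → X ⊆ insert eq e X
⊆-insert eq e X a Xa = trans (cong (eq e a ∨_) Xa) (∨-zeroʳ (eq e a))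

insert-self : ∀ {A : Set} (eq : A → A → Bool) {e} (X : Subset A) →
              eq e e ≡ true → insert eq e X e ≡ true
insert-self eq X eqee = cong (_∨ X _) eqee

module Layered {A U : Set} {W : ℕ}
  (slot : Fin W → A → Maybe U)
  (slot-injective : ∀ {i j a b u} → slot i a ≡ just u → slot j b ≡ just u → i ≡ j × a ≡ b)
  (layer : Subset U → Fin W → Subset A)
  (layer-slot : ∀ X i a → layer X i a ≡ maybe′ X false (slot i a))
  where

  layer-just : ∀ {X i a u} → slot i a ≡ just u → layer X i a ≡ X u
  layer-just {X} {i} {a} slot≡u = trans (layer-slot X i a) (cong (maybe′ X false) slot≡u)

  layer-true : ∀ {X i a} → layer X i a ≡ true → ∃[ u ] slot i a ≡ just u × X u ≡ true
  layer-true {X} {i} {a} h with slot i a | layer-slot X i a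
  ... | just u  | ls = u , refl , trans (sym ls) h
  ... | nothing | ls with () ← trans (sym h) ls

  layer-∅ : ∀ {i} → layer ∅ i ⊆ ∅
  layer-∅ a h with _ , _ , () ← layer-true h

  layer-mono : ∀ {X Y} → X ⊆ Y → ∀ i → layer X i ⊆ layer Y i
  layer-mono X⊆Y i a h with u , slot≡u , Xu ← layer-true h =
    trans (layer-just slot≡u) (X⊆Y u Xu)

  module _ {eqU : U → U → Bool} (eqU-sound : ∀ u v → eqU u v ≡ true → u ≡ v) where

    layer-insert : ∀ {X i j a b u} → slot i a ≡ just u → layer (insert eqU u X) j b ≡ true →
                   layer X j b ≡ true ⊎ (j ≡ i × b ≡ a)
    layer-insert {u = u} slot≡u h with layer-true h
    ... | v , slot≡v , u∨Xv with eqU u v in u≟v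
    ...   | true with refl ← eqU-sound u v u≟v = inj₂ (slot-injective slot≡v slot≡u)
    ...   | false = inj₁ (trans (layer-just slot≡v) u∨Xv)

    layer-insert-same : ∀ {X i a u} (eqA : A → A → Bool) → eqA a a ≡ true →
                        slot i a ≡ just u → layer (insert eqU u X) i ⊆ insert eqA a (layer X i)
    layer-insert-same {X} {i} eqA eqaa slot≡u b h with layer-insert slot≡u h
    ... | inj₁ Xb          = ⊆-insert eqA _ (layer X i) b Xb
    ... | inj₂ (_ , refl) = insert-self eqA (layer X i) eqaa

    layer-insert-other : ∀ {X i j a u} → j ≢ i → slot i a ≡ just u →
                         layer (insert eqU u X) j ⊆ layer X j
    layer-insert-other j≢i slot≡u b h with layer-insert slot≡u h
    ... | inj₁ Xb         = Xb
    ... | inj₂ (j≡i , _) = contradiction j≡i j≢i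

    isMatroid : ∀ {enumA : List A} {eqA : A → A → Bool} {enumU : List U}
                  {I' : Subset A → Set} →
                (∀ a → eqA a a ≡ true) →
                (∀ X → card enumU X ≡ ∑[ i < W ] card enumA (layer X i)) →
                IsMatroid enumA eqA I' → IsMatroid enumU eqU (λ X → ∀ i → I' (layer X i))
    isMatroid {eqA = eqA} {enumU} {I'} eqA-refl card-layers M = record
      { empty      = λ i → hereditary _ _ layer-∅ empty
      ; hereditary = λ X Y X⊆Y indY i → hereditary _ _ (layer-mono X⊆Y i) (indY i)
      ; exchange   = layered-exchange
      }
      where
      open IsMatroid M

      layered-exchange : ∀ X Y → (∀ i → I' (layer X i)) → (∀ i → I' (layer Y i)) →
                         card enumU X < card enumU Y →
                         ∃[ u ] (Y u ≡ true × X u ≡ false ×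
                                 (∀ j → I' (layer (insert eqU u X) j)))
      layered-exchange X Y indX indY |X|<|Y|
        with i , |Xᵢ|<|Yᵢ| ←
               ∑-<⇒∃< _ _ (subst₂ _<_ (card-layers X) (card-layers Y) |X|<|Y|)
        with a , Yᵢa , Xᵢa , indXᵢ+a ← exchange _ _ (indX i) (indY i) |Xᵢ|<|Yᵢ|
        with u , slot≡u , Yu ← layer-true Yᵢa
        = u , Yu , trans (sym (layer-just slot≡u)) Xᵢa , indX+u
        where
        indX+u : ∀ j → I' (layer (insert eqU u X) j)
        indX+u j with j Fin.≟ i
        ... | yes refl = hereditary _ _ (layer-insert-same eqA (eqA-refl a) slot≡u) indXᵢ+a
        ... | no  j≢i  = hereditary _ _ (layer-insert-other j≢i slot≡u) (indX j)

eqFin-refl : ∀ {n} (e : Fin n) → eqFin e e ≡ true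
eqFin-refl e with toℕ e ≟ toℕ e
... | yes _  = refl
... | no e≢e = contradiction refl e≢e

eqUnfold-sound : ∀ {n} {w : Fin n → ℕ} (u v : Unfold n w) → eqUnfold u v ≡ true → u ≡ v
eqUnfold-sound (e , k) (f , l) h with toℕ e ≟ toℕ f | toℕ k ≟ toℕ l
eqUnfold-sound (e , k) (f , l) h  | yes e≡f | yes k≡l with refl ← toℕ-injective e≡f =
  cong (e ,_) (toℕ-injective k≡l)
eqUnfold-sound (e , k) (f , l) () | yes _   | no _
eqUnfold-sound (e , k) (f , l) () | no _    | _

module _ {n : ℕ} {w : Fin n → ℕ} where

  copySlot : Fin n → ℕ → Maybe (Unfold n w)
  copySlot e j with j <? w e
  ... | yes j<w = just (e , fromℕ< j<w)
  ... | no  _   = nothing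

  copy-slot : ∀ (X : Subset (Unfold n w)) e j →
              copy {w = w} X e j ≡ maybe′ X false (copySlot e j)
  copy-slot X e j with j <? w e
  ... | yes _ = refl
  ... | no  _ = refl

  copySlot-just : ∀ {e j f k} → copySlot e j ≡ just (f , k) → f ≡ e × toℕ k ≡ j
  copySlot-just {e} {j} slot≡ with j <? w e
  copySlot-just {e} {j} refl | yes j<w = refl , toℕ-fromℕ< j<w
  copySlot-just {e} {j} ()   | no  _

  copy-≥ : ∀ (X : Subset (Unfold n w)) {e j} → w e ≤ j → copy {w = w} X e j ≡ false
  copy-≥ X {e} {j} w≤j with j <? w e
  ... | yes j<w = contradiction w≤j (<⇒≱ j<w)
  ... | no  _   = refl

  copy-toℕ : ∀ (X : Subset (Unfold n w)) {e j} {k : Fin (w e)} → j ≡ toℕ k →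
             copy {w = w} X e j ≡ X (e , k)
  copy-toℕ X {e} {k = k} refl with toℕ k <? w e
  ... | yes k<w = cong (λ k → X (e , k)) (fromℕ<-toℕ k k<w)
  ... | no  k≮w = contradiction (toℕ<n k) k≮w

module Unfolding {n W : ℕ} {w : Fin n → ℕ} (w≤W : ∀ e → w e ≤ W) where

  open ≡-Reasoning

  slot₁ : Fin W → Fin n → Maybe (Unfold n w)
  slot₁ i e = copySlot e (toℕ i)

  slot₁-injective : ∀ {i j a b u} → slot₁ i a ≡ just u → slot₁ j b ≡ just u → i ≡ j × a ≡ b
  slot₁-injective {u = f , k} slotᵢ slotⱼ with copySlot-just slotᵢ | copySlot-just slotⱼ
  ... | refl , k≡i | refl , k≡j = toℕ-injective (trans (sym k≡i) k≡j) , refl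

  fibre₁ : ∀ X e → ∑[ i < W ] 𝟙 (proj1 X i e) ≡ ∑[ k < w e ] 𝟙 (X (e , k))
  fibre₁ X e = begin
    ∑[ i < W ] 𝟙 (proj1 X i e)
      ≡⟨ ∑-inject≤ (w≤W e) _ (λ i w≤i → cong 𝟙 (copy-≥ X w≤i)) ⟩
    ∑[ k < w e ] 𝟙 (proj1 X (inject≤ k (w≤W e)) e)
      ≡⟨ sum-cong-≗ (λ k → cong 𝟙 (copy-toℕ X (toℕ-inject≤ k (w≤W e)))) ⟩
    ∑[ k < w e ] 𝟙 (X (e , k))
      ∎

  Unfolded1-isMatroid : ∀ {I'} → IsMatroid (enumFin n) eqFin I' →
                        IsMatroid (enumUnfold n w) eqUnfold (Unfolded1 W w I')
  Unfolded1-isMatroid =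
    Layered.isMatroid slot₁ slot₁-injective proj1 (λ X i e → copy-slot X e (toℕ i))
      eqUnfold-sound eqFin-refl (card-enumUnfold-layers {W = W} {w = w} proj1 fibre₁)

  slot₂ : Fin W → Fin n → Maybe (Unfold n w)
  slot₂ i e with suc (toℕ i) ≤? w e
  ... | yes _ = copySlot e (w e ∸ suc (toℕ i))
  ... | no  _ = nothing

  layer-slot₂ : ∀ X i e → proj2 X i e ≡ maybe′ X false (slot₂ i e)
  layer-slot₂ X i e with suc (toℕ i) ≤? w e
  ... | yes _ = copy-slot X e (w e ∸ suc (toℕ i))
  ... | no  _ = refl

  slot₂-just : ∀ {i e f k} → slot₂ i e ≡ just (f , k) →
               f ≡ e × toℕ i < w e × toℕ k ≡ w e ∸ suc (toℕ i)
  slot₂-just {i} {e} slot≡ with suc (toℕ i) ≤? w e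
  slot₂-just {i} {e} slot≡ | yes i<w with refl , k≡ ← copySlot-just slot≡ =
    refl , i<w , k≡
  slot₂-just {i} {e} ()    | no  _

  slot₂-injective : ∀ {i j a b u} → slot₂ i a ≡ just u → slot₂ j b ≡ just u → i ≡ j × a ≡ b
  slot₂-injective {u = f , k} slotᵢ slotⱼ with slot₂-just slotᵢ | slot₂-just slotⱼ
  ... | refl , i<w , k≡ | refl , j<w , k≡′ =
    toℕ-injective (suc-injective (∸-cancelˡ-≡ i<w j<w (trans (sym k≡) k≡′))) , refl

  proj2-≥ : ∀ (X : Subset (Unfold n w)) {i e} → w e ≤ toℕ i → proj2 {W = W} X i e ≡ false
  proj2-≥ X {i} {e} w≤i with suc (toℕ i) ≤? w e
  ... | yes i<w = contradiction w≤i (<⇒≱ i<w)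
  ... | no  _   = refl

  proj2-inject≤ : ∀ X {e} (k : Fin (w e)) →
                  proj2 X (inject≤ k (w≤W e)) e ≡ X (e , opposite k)
  proj2-inject≤ X {e} k
    with toℕ-k ← toℕ-inject≤ k (w≤W e) | suc (toℕ (inject≤ k (w≤W e))) ≤? w e
  ... | yes _   = copy-toℕ X (trans (cong (λ j → w e ∸ suc j) toℕ-k) (sym (opposite-prop k)))
  ... | no  k≮w = contradiction (subst (_< w e) (sym toℕ-k) (toℕ<n k)) k≮w

  fibre₂ : ∀ X e → ∑[ i < W ] 𝟙 (proj2 X i e) ≡ ∑[ k < w e ] 𝟙 (X (e , k))
  fibre₂ X e = begin
    ∑[ i < W ] 𝟙 (proj2 X i e)
      ≡⟨ ∑-inject≤ (w≤W e) _ (λ i w≤i → cong 𝟙 (proj2-≥ X w≤i)) ⟩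
    ∑[ k < w e ] 𝟙 (proj2 X (inject≤ k (w≤W e)) e)
      ≡⟨ sum-cong-≗ (λ k → cong 𝟙 (proj2-inject≤ X k)) ⟩
    ∑[ k < w e ] 𝟙 (X (e , opposite k))
      ≡⟨ ∑-permute (λ k → 𝟙 (X (e , k))) reverse ⟨
    ∑[ k < w e ] 𝟙 (X (e , k))
      ∎

  Unfolded2-isMatroid : ∀ {I'} → IsMatroid (enumFin n) eqFin I' →
                        IsMatroid (enumUnfold n w) eqUnfold (Unfolded2 W w I')
  Unfolded2-isMatroid =
    Layered.isMatroid slot₂ slot₂-injective proj2 layer-slot₂
      eqUnfold-sound eqFin-refl (card-enumUnfold-layers {W = W} {w = w} proj2 fibre₂)

lemma2 : (n W : ℕ) (w : Fin n → ℕ) →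
         (∀ e → 1 ≤ w e × w e ≤ W) →
         (I₁' I₂' : Subset (Fin n) → Set) →
         IsMatroid (enumFin n) eqFin I₁' →
         IsMatroid (enumFin n) eqFin I₂' →
         IsMatroid (enumUnfold n w) eqUnfold (Unfolded1 W w I₁')
           × IsMatroid (enumUnfold n w) eqUnfold (Unfolded2 W w I₂')
lemma2 n W w bounds I₁' I₂' M₁ M₂ = Unfolded1-isMatroid M₁ , Unfolded2-isMatroid M₂
  where open Unfolding (proj₂ ∘ bounds)
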